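{- Let $\mathbf{ILX}$ be a logic extending $\mathbf{IL}$ that contains every instance of $\mathsf R$: $A\rhd B\to\neg(A\rhd\neg C)\rhd B\wedge\Box C$. For $\mathbf{ILX}$-MCSs $\Gamma,\Lambda,\Delta$ and sets of formulas $S,T$: if $\Gamma\prec_S\Lambda\prec_T\Delta$ then $\Gamma\prec_{S\cup\Lambda^{\Box}_T}\Delta$.
   Context: Formulas: $\bot$, propositional variables, $\to$, $\Box$, binary $\rhd$; $\Diamond A:=\neg\Box\neg A$. $\mathbf{IL}$: classical tautologies, K, L: $\Box(\Box A\to A)\to\Box A$, J1: $\Box(A\to B)\to A\rhd B$, J2: $(A\rhd B)\wedge(B\rhd C)\to A\rhd C$, J3: $(A\rhd C)\wedge(B\rhd C)\to A\vee B\rhd C$, J4: $A\rhd B\to(\Diamond A\to\Diamond B)$, J5: $\Diamond A\rhd A$; rules modus ponens and necessitation. An $\mathbf{ILX}$-MCS is a maximal $\mathbf{ILX}$-consistent set. $\Gamma\prec_S\Delta$ iff for every formula $A$ and finite $S'\subseteq S$, $\neg A\rhd\bigvee_{\sigma\in S'}\neg\sigma\in\Gamma$ implies $A,\Box A\in\Delta$ (empty disjunction is $\bot$). $\Lambda^{\Box}_T=\{\Box A:\neg A\rhd\bigvee_{\sigma\in T'}\neg\sigma\in\Lambda$ for some finite $T'\subseteq T\}$. -}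

module Defs where

open import Data.Nat using (ℕ)
open import Data.Bool using (Bool; true; false; not; _∧_; _∨_)
open import Data.List using (List; []; _∷_; map)
open import Data.List.Relation.Unary.All using (All)
open import Data.Product using (Σ; _×_)
open import Data.Sum using (_⊎_)
open import Relation.Binary.PropositionalEquality using (_≡_)
open import Relation.Nullary using (¬_)

infixr 5 _⇒_
infix 6 _▷_
data Fm : Set where
  ⊥' : Fm
  var : ℕ → Fm
  _⇒_ : Fm → Fm → Fm
  □ : Fm → Fm
  _▷_ : Fm → Fm → Fm

~_ : Fm → Fm
~ A = A ⇒ ⊥'

⊤' : Fm
⊤' = ~ ⊥'

_∨'_ : Fm → Fm → Fm
A ∨' B = (~ A) ⇒ B

_∧'_ : Fm → Fm → Fm
A ∧' B = ~ (A ⇒ ~ B)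

◇ : Fm → Fm
◇ A = ~ □ (~ A)

⋁ : List Fm → Fm
⋁ [] = ⊥'
⋁ (A ∷ As) = A ∨' ⋁ As

⋀ : List Fm → Fm
⋀ [] = ⊤'
⋀ (A ∷ As) = A ∧' ⋀ As

-- Classical tautologies: true under every Boolean valuation of the
-- "atoms" (variables, □-formulas and ▷-formulas).
eval : (Fm → Bool) → Fm → Bool
eval w ⊥' = false
eval w (var n) = w (var n)
eval w (A ⇒ B) = not (eval w A) ∨ eval w B
eval w (□ A) = w (□ A)
eval w (A ▷ B) = w (A ▷ B)

Tautology : Fm → Set
Tautology A = (w : Fm → Bool) → eval w A ≡ true

R-inst : Fm → Fm → Fm → Fm
R-inst A B C = (A ▷ B) ⇒ ((~ (A ▷ ~ C)) ▷ (B ∧' □ C))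

-- Derivability in IL extended by an arbitrary set X of extra axioms.
-- Any logic extending IL (closed under MP and necessitation) is of the
-- form {A | ⊢[ X ] A} (take X to be the logic itself).
data ⊢[_]_ (X : Fm → Set) : Fm → Set where
  taut : ∀ {A} → Tautology A → ⊢[ X ] A
  axK  : ∀ A B → ⊢[ X ] (□ (A ⇒ B) ⇒ (□ A ⇒ □ B))
  axL  : ∀ A → ⊢[ X ] (□ (□ A ⇒ A) ⇒ □ A)
  axJ1 : ∀ A B → ⊢[ X ] (□ (A ⇒ B) ⇒ (A ▷ B))
  axJ2 : ∀ A B C → ⊢[ X ] (((A ▷ B) ∧' (B ▷ C)) ⇒ (A ▷ C))
  axJ3 : ∀ A B C → ⊢[ X ] (((A ▷ C) ∧' (B ▷ C)) ⇒ ((A ∨' B) ▷ C))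
  axJ4 : ∀ A B → ⊢[ X ] ((A ▷ B) ⇒ (◇ A ⇒ ◇ B))
  axJ5 : ∀ A → ⊢[ X ] (◇ A ▷ A)
  extra : ∀ {A} → X A → ⊢[ X ] A
  mp   : ∀ {A B} → ⊢[ X ] (A ⇒ B) → ⊢[ X ] A → ⊢[ X ] B
  nec  : ∀ {A} → ⊢[ X ] A → ⊢[ X ] (□ A)

FmSet : Set₁
FmSet = Fm → Set

_∪_ : FmSet → FmSet → FmSet
(S ∪ T) B = S B ⊎ T B

Consistent : (Fm → Set) → FmSet → Set
Consistent X Γ = ¬ (Σ (List Fm) λ L → All Γ L × ⊢[ X ] (⋀ L ⇒ ⊥'))

MCS : (Fm → Set) → FmSet → Set
MCS X Γ = Consistent X Γ × ((A : Fm) → Consistent X (λ B → Γ B ⊎ B ≡ A) → Γ A)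

-- Γ ≺_S Δ  (finite S' ⊆ S represented by a list of members of S)
_≺[_]_ : FmSet → FmSet → FmSet → Set
Γ ≺[ S ] Δ = (A : Fm) (S' : List Fm) → All S S' →
  Γ ((~ A) ▷ ⋁ (map ~_ S')) → Δ A × Δ (□ A)

BoxSet : FmSet → FmSet → FmSet
BoxSet Λ T B = Σ Fm λ A → B ≡ □ A ×
  Σ (List Fm) λ T' → All T T' × Λ ((~ A) ▷ ⋁ (map ~_ T'))

module Submission where

-- Take ¬A ▷ ⋁¬U ∈ Γ with U ⊆ S ∪ Λ^□_T.  Split U into S' ⊆ S and boxes
-- □B₁ … □Bₙ with ¬Bᵢ ▷ ⋁¬Tᵢ ∈ Λ (Tᵢ ⊆ T).  Put C = ⋀Bᵢ and T' = T₁ ++ … ++ Tₙ;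
-- by J3 and monotonicity, ¬C ▷ ⋁¬T' ∈ Λ.  In Γ we have ¬A ▷ (⋁¬S' ∨ ⋁¬□Bᵢ),
-- so R gives ¬(¬A ▷ ¬C) ▷ ((⋁¬S' ∨ ⋁¬□Bᵢ) ∧ □C), whose consequent implies
-- ⋁¬S' because □C entails every □Bᵢ.  Now Γ ≺_S Λ yields ¬A ▷ ¬C ∈ Λ, hence
-- ¬A ▷ ⋁¬T' ∈ Λ by J2, and Λ ≺_T Δ gives A, □A ∈ Δ.

open import Defs
open import Data.Bool using (Bool; true; false; not; _∨_)
open import Data.Empty using (⊥-elim)
open import Data.List using (List; []; _∷_; map; _++_)
open import Data.List.Relation.Unary.All using (All; []; _∷_; lookupAny)
open import Data.List.Relation.Unary.Any using (Any; here; there)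
import Data.List.Relation.Unary.All.Properties as All
import Data.List.Relation.Unary.Any.Properties as Any
open import Data.Product using (Σ; _×_; _,_; proj₁; proj₂)
open import Data.Sum using (_⊎_; inj₁; inj₂; [_,_]′)
open import Relation.Binary.PropositionalEquality using (_≡_; refl; sym; trans)
open import Relation.Nullary using (¬_)

private
  variable
    w : Fm → Bool
    A B P Q R : Fm
    L Ps : List Fm

infix 4 _⊨_
record _⊨_ (w : Fm → Bool) (A : Fm) : Set where
  constructor sat
  field truth : eval w A ≡ true
open _⊨_

implication-elim : ∀ b {c} → not b ∨ c ≡ true → b ≡ true → c ≡ true
implication-elim true h _ = h

implication-intro : ∀ b c → (b ≡ true → c ≡ true) → not b ∨ c ≡ true
implication-intro false c _ = refl
implication-intro true  c f = f refl

⇒-elim : w ⊨ (A ⇒ B) → w ⊨ A → w ⊨ B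
⇒-elim {w} {A} (sat h) (sat a) = sat (implication-elim (eval w A) h a)

⇒-intro : (w ⊨ A → w ⊨ B) → w ⊨ (A ⇒ B)
⇒-intro {w} {A} {B} f =
  sat (implication-intro (eval w A) (eval w B) (λ a → truth (f (sat a))))

⊥-unsat : ¬ (w ⊨ ⊥')
⊥-unsat (sat ())

decide : (w : Fm → Bool) (A : Fm) → w ⊨ A ⊎ ¬ (w ⊨ A)
decide w A with eval w A in eq
... | true  = inj₁ (sat eq)
... | false = inj₂ (λ (sat t) → false≢true (trans (sym eq) t))
  where
  false≢true : ¬ (false ≡ true)
  false≢true ()

~-intro : ¬ (w ⊨ A) → w ⊨ ~ A
~-intro f = ⇒-intro (λ a → ⊥-elim (f a))

~-elim : w ⊨ ~ A → ¬ (w ⊨ A)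
~-elim h a = ⊥-unsat (⇒-elim h a)

⊤-sat : w ⊨ ⊤'
⊤-sat = sat refl

∨-introˡ : w ⊨ A → w ⊨ (A ∨' B)
∨-introˡ a = ⇒-intro (λ na → ⊥-elim (~-elim na a))

∨-introʳ : w ⊨ B → w ⊨ (A ∨' B)
∨-introʳ b = ⇒-intro (λ _ → b)

∨-elim : w ⊨ (A ∨' B) → w ⊨ A ⊎ w ⊨ B
∨-elim {w} {A} h = [ inj₁ , (λ na → inj₂ (⇒-elim h (~-intro na))) ]′ (decide w A)

∧-intro : w ⊨ A → w ⊨ B → w ⊨ (A ∧' B)
∧-intro a b = ~-intro (λ a⇒¬b → ~-elim (⇒-elim a⇒¬b a) b)

∧-elimˡ : w ⊨ (A ∧' B) → w ⊨ A
∧-elimˡ {w} {A} h =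
  [ (λ a → a) , (λ na → ⊥-elim (~-elim h (⇒-intro (λ a → ⊥-elim (na a))))) ]′ (decide w A)

∧-elimʳ : w ⊨ (A ∧' B) → w ⊨ B
∧-elimʳ {w} {B = B} h =
  [ (λ b → b) , (λ nb → ⊥-elim (~-elim h (⇒-intro (λ _ → ~-intro nb)))) ]′ (decide w B)

⋁-Any : w ⊨ ⋁ L → Any (w ⊨_) L
⋁-Any {L = []}    h = ⊥-elim (⊥-unsat h)
⋁-Any {L = _ ∷ _} h = [ here , (λ rest → there (⋁-Any rest)) ]′ (∨-elim h)

Any-⋁ : Any (w ⊨_) L → w ⊨ ⋁ L
Any-⋁ (here a)    = ∨-introˡ a
Any-⋁ (there any) = ∨-introʳ (Any-⋁ any)

⋀-All : w ⊨ ⋀ L → All (w ⊨_) L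
⋀-All {L = []}    _ = []
⋀-All {L = _ ∷ _} h = ∧-elimˡ h ∷ ⋀-All (∧-elimʳ h)

All-⋀ : All (w ⊨_) L → w ⊨ ⋀ L
All-⋀ []       = ⊤-sat
All-⋀ (a ∷ as) = ∧-intro a (All-⋀ as)

module Derivations (X : Fm → Set) where

  valid-⇒ : (∀ w → w ⊨ P → w ⊨ Q) → ⊢[ X ] (P ⇒ Q)
  valid-⇒ f = taut (λ w → truth (⇒-intro (f w)))

  tautological : All (⊢[ X ]_) Ps → (∀ w → All (w ⊨_) Ps → w ⊨ Q) → ⊢[ X ] Q
  tautological []       f = taut (λ w → truth (f w []))
  tautological (d ∷ ds) f = mp (tautological ds (λ w hs → ⇒-intro (λ h → f w (h ∷ hs)))) d

  uncurry-∧ : ⊢[ X ] ((P ∧' Q) ⇒ R) → ⊢[ X ] (P ⇒ Q ⇒ R)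
  uncurry-∧ d = tautological (d ∷ [])
    λ { w (pq⇒r ∷ []) → ⇒-intro (λ p → ⇒-intro (λ q → ⇒-elim pq⇒r (∧-intro p q))) }

  □-mono : ⊢[ X ] (P ⇒ Q) → ⊢[ X ] (□ P ⇒ □ Q)
  □-mono {P} {Q} d = mp (axK P Q) (nec d)

  ⇒-to-▷ : ⊢[ X ] (P ⇒ Q) → ⊢[ X ] (P ▷ Q)
  ⇒-to-▷ {P} {Q} d = mp (axJ1 P Q) (nec d)

  □-⋀ : (Bs : List Fm) → ⊢[ X ] (□ (⋀ Bs) ⇒ ⋀ (map □ Bs))
  □-⋀ []       = valid-⇒ (λ _ _ → ⊤-sat)
  □-⋀ (B ∷ Bs) =
    tautological (□-mono (valid-⇒ (λ _ → ∧-elimˡ)) ∷ □-mono (valid-⇒ (λ _ → ∧-elimʳ)) ∷ □-⋀ Bs ∷ [])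
      λ { w (□head ∷ □tail ∷ □⋀tail ∷ []) → ⇒-intro (λ □c →
            ∧-intro (⇒-elim □head □c) (⇒-elim □⋀tail (⇒-elim □tail □c))) }

  -- □⋀Bs refutes every disjunct ¬□B (B ∈ Bs), leaving only P.
  boxes-refute : (Bs : List Fm) →
    ⊢[ X ] (((P ∨' ⋁ (map (λ B → ~ □ B) Bs)) ∧' □ (⋀ Bs)) ⇒ P)
  boxes-refute Bs = tautological (□-⋀ Bs ∷ [])
    λ { w (□⋀ ∷ []) → ⇒-intro (λ h →
          [ (λ p → p)
          , (λ refuted →
               let boxes = All.map⁻ (⋀-All (⇒-elim □⋀ (∧-elimʳ h)))
                   (□b , ¬□b) = lookupAny boxes (Any.map⁻ (⋁-Any refuted))
               in ⊥-elim (~-elim ¬□b □b))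
          ]′ (∨-elim (∧-elimˡ h))) }

  module Closure {Γ : FmSet} (mΓ : MCS X Γ) where

    set-aside : All (λ B → Γ B ⊎ B ≡ Q) L →
      Σ (List Fm) λ K → All Γ K × (∀ w → All (w ⊨_) K → w ⊨ Q → All (w ⊨_) L)
    set-aside [] = [] , [] , (λ _ _ _ → [])
    set-aside {L = B ∷ _} (inj₁ γ ∷ rest) =
      let (K , K⊆Γ , entails) = set-aside rest
      in B ∷ K , γ ∷ K⊆Γ , λ { w (b ∷ k) q → b ∷ entails w k q }
    set-aside (inj₂ refl ∷ rest) =
      let (K , K⊆Γ , entails) = set-aside rest
      in K , K⊆Γ , λ w k q → q ∷ entails w k q

    closed : All Γ Ps → ⊢[ X ] (⋀ Ps ⇒ Q) → Γ Q
    closed {Ps} Ps⊆Γ Ps⇒Q = proj₂ mΓ _ λ (L , L⊆Γ∪Q , L⇒⊥) →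
      let (K , K⊆Γ , entails) = set-aside L⊆Γ∪Q
      in proj₁ mΓ (Ps ++ K , All.++⁺ Ps⊆Γ K⊆Γ ,
           tautological (Ps⇒Q ∷ L⇒⊥ ∷ [])
             λ { w (ps⇒q ∷ l⇒⊥ ∷ []) → ⇒-intro (λ h →
                   let (ps , k) = All.++⁻ Ps (⋀-All h)
                   in ⇒-elim l⇒⊥ (All-⋀ (entails w k (⇒-elim ps⇒q (All-⋀ ps))))) })

    theorem∈ : ⊢[ X ] Q → Γ Q
    theorem∈ d = closed [] (tautological (d ∷ []) λ { w (q ∷ []) → ⇒-intro (λ _ → q) })

    mp∈ : Γ P → ⊢[ X ] (P ⇒ Q) → Γ Q
    mp∈ {P} γ d = closed (γ ∷ [])
      (tautological (d ∷ []) λ { w (p⇒q ∷ []) → ⇒-intro (λ h → ⇒-elim p⇒q (∧-elimˡ h)) })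

    mp₂∈ : Γ P → Γ Q → ⊢[ X ] (P ⇒ Q ⇒ R) → Γ R
    mp₂∈ γ γ' d = closed (γ ∷ γ' ∷ [])
      (tautological (d ∷ []) λ { w (p⇒q⇒r ∷ []) → ⇒-intro (λ h →
         ⇒-elim (⇒-elim p⇒q⇒r (∧-elimˡ h)) (∧-elimˡ (∧-elimʳ h))) })

    ▷-trans : Γ (P ▷ Q) → Γ (Q ▷ R) → Γ (P ▷ R)
    ▷-trans {P} {Q} {R} γ γ' = mp₂∈ γ γ' (uncurry-∧ (axJ2 P Q R))

    ▷-join : Γ (P ▷ R) → Γ (Q ▷ R) → Γ ((P ∨' Q) ▷ R)
    ▷-join {P} {R} {Q} γ γ' = mp₂∈ γ γ' (uncurry-∧ (axJ3 P Q R))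

    ▷-weaken : Γ (P ▷ Q) → ⊢[ X ] (Q ⇒ R) → Γ (P ▷ R)
    ▷-weaken γ d = ▷-trans γ (theorem∈ (⇒-to-▷ d))

    ▷-strengthen : ⊢[ X ] (P ⇒ Q) → Γ (Q ▷ R) → Γ (P ▷ R)
    ▷-strengthen d γ = ▷-trans (theorem∈ (⇒-to-▷ d)) γ

    ▷-¬∧ : Γ (~ P ▷ Q) → Γ (~ R ▷ B) → Γ (~ (P ∧' R) ▷ (Q ∨' B))
    ▷-¬∧ {P} {R = R} γ γ' =
      ▷-strengthen (valid-⇒ de-Morgan)
        (▷-join (▷-weaken γ (valid-⇒ (λ _ → ∨-introˡ))) (▷-weaken γ' (valid-⇒ (λ _ → ∨-introʳ))))
      where
      de-Morgan : ∀ w → w ⊨ ~ (P ∧' R) → w ⊨ ((~ P) ∨' (~ R))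
      de-Morgan w h = [ (λ p → ∨-introʳ (~-intro (λ r → ~-elim h (∧-intro p r))))
                      , (λ np → ∨-introˡ (~-intro np)) ]′ (decide w P)

  module Splitting (Λ S T : FmSet) (mΛ : MCS X Λ) where
    open Closure mΛ

    record Decomposition (U : List Fm) : Set where
      field
        S'     : List Fm
        S'⊆S   : All S S'
        Bs     : List Fm
        T'     : List Fm
        T'⊆T   : All T T'
        boxes▷ : Λ (~ ⋀ Bs ▷ ⋁ (map ~_ T'))
        covers : ∀ w → Any (λ σ → w ⊨ ~ σ) U →
                 Any (λ σ → w ⊨ ~ σ) S' ⊎ Any (λ B → w ⊨ ~ □ B) Bs

    open Decomposition

    ¬⊤▷⊥ : Λ (~ ⋀ [] ▷ ⋁ (map ~_ []))
    ¬⊤▷⊥ = theorem∈ (⇒-to-▷ (valid-⇒ (λ _ h → ⊥-elim (~-elim h ⊤-sat))))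

    ⋁~-++ˡ : (T₁ T₂ : List Fm) → ⊢[ X ] (⋁ (map ~_ T₁) ⇒ ⋁ (map ~_ (T₁ ++ T₂)))
    ⋁~-++ˡ T₁ T₂ = valid-⇒ (λ _ h → Any-⋁ (Any.map⁺ (Any.++⁺ˡ (Any.map⁻ (⋁-Any h)))))

    ⋁~-++ʳ : (T₁ T₂ : List Fm) → ⊢[ X ] (⋁ (map ~_ T₂) ⇒ ⋁ (map ~_ (T₁ ++ T₂)))
    ⋁~-++ʳ T₁ T₂ = valid-⇒ (λ _ h → Any-⋁ (Any.map⁺ (Any.++⁺ʳ T₁ (Any.map⁻ (⋁-Any h)))))

    decompose : {U : List Fm} → All (S ∪ BoxSet Λ T) U → Decomposition U
    decompose [] = record
      { S' = [] ; S'⊆S = [] ; Bs = [] ; T' = [] ; T'⊆T = []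
      ; boxes▷ = ¬⊤▷⊥ ; covers = λ _ () }
    decompose {σ ∷ _} (inj₁ σ∈S ∷ rest) = let d = decompose rest in record
      { S' = σ ∷ S' d ; S'⊆S = σ∈S ∷ S'⊆S d ; Bs = Bs d ; T' = T' d ; T'⊆T = T'⊆T d
      ; boxes▷ = boxes▷ d
      ; covers = λ { w (here ¬σ) → inj₁ (here ¬σ)
                   ; w (there any) → [ (λ s → inj₁ (there s)) , inj₂ ]′ (covers d w any) } }
    decompose (inj₂ (B , refl , Tᵦ , Tᵦ⊆T , ¬B▷Tᵦ) ∷ rest) = let d = decompose rest in record
      { S' = S' d ; S'⊆S = S'⊆S d ; Bs = B ∷ Bs d ; T' = Tᵦ ++ T' d
      ; T'⊆T = All.++⁺ Tᵦ⊆T (T'⊆T d)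
      ; boxes▷ = ▷-weaken (▷-¬∧ ¬B▷Tᵦ (boxes▷ d))
          (tautological (⋁~-++ˡ Tᵦ (T' d) ∷ ⋁~-++ʳ Tᵦ (T' d) ∷ [])
            λ { w (l ∷ r ∷ []) → ⇒-intro (λ h → [ ⇒-elim l , ⇒-elim r ]′ (∨-elim h)) })
      ; covers = λ { w (here ¬□B) → inj₂ (here ¬□B)
                   ; w (there any) → [ inj₁ , (λ b → inj₂ (there b)) ]′ (covers d w any) } }

lemma6p5 : (X : Fm → Set) →
    ((A B C : Fm) → ⊢[ X ] R-inst A B C) →
    (Γ Λ Δ S T : FmSet) →
    MCS X Γ → MCS X Λ → MCS X Δ →
    Γ ≺[ S ] Λ → Λ ≺[ T ] Δ →
    Γ ≺[ S ∪ BoxSet Λ T ] Δ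
lemma6p5 X axR Γ Λ Δ S T mΓ mΛ _ Γ≺Λ Λ≺Δ A U U⊆ ¬A▷U =
  Λ≺Δ A T' T'⊆T (▷-trans mΛ ¬A▷¬⋀B boxes▷)
  where
  open Derivations X
  open Closure using (▷-trans; ▷-weaken; mp∈)
  open Splitting Λ S T mΛ
  open Decomposition (decompose U⊆)
  ⋀B : Fm
  ⋀B = ⋀ Bs

  Y : Fm
  Y = ⋁ (map ~_ S') ∨' ⋁ (map (λ B → ~ □ B) Bs)

  ¬A▷Y : Γ (~ A ▷ Y)
  ¬A▷Y = ▷-weaken mΓ ¬A▷U (valid-⇒ λ w h →
    [ (λ s → ∨-introˡ (Any-⋁ (Any.map⁺ s))) , (λ b → ∨-introʳ (Any-⋁ (Any.map⁺ b))) ]′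
      (covers w (Any.map⁻ (⋁-Any h))))

  -- R turns ¬A ▷ Y into ¬(¬A ▷ ¬⋀B) ▷ Y ∧ □⋀B, which interprets ⋁¬S'.
  ¬[¬A▷¬⋀B]▷S' : Γ (~ (~ A ▷ ~ ⋀B) ▷ ⋁ (map ~_ S'))
  ¬[¬A▷¬⋀B]▷S' = ▷-weaken mΓ (mp∈ mΓ ¬A▷Y (axR (~ A) Y ⋀B)) (boxes-refute Bs)

  ¬A▷¬⋀B : Λ (~ A ▷ ~ ⋀B)
  ¬A▷¬⋀B = proj₁ (Γ≺Λ (~ A ▷ ~ ⋀B) S' S'⊆S ¬[¬A▷¬⋀B]▷S')
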